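{- The subword patterns $1121$ and $1221$ are in the same strong Wilf class: for all integers $k\ge1$, $n\ge0$, $r\ge0$, the number of words in $[k]^n$ containing $1121$ exactly $r$ times equals the number of words in $[k]^n$ containing $1221$ exactly $r$ times.
   Context: $[k]^n$ is the set of words of length $n$ over $\{1,\dots,k\}$. An occurrence of a subword pattern $\tau$ of length $l$ in a word $\sigma=\sigma_1\cdots\sigma_n$ is an index $i$ such that the consecutive factor $\sigma_i\cdots\sigma_{i+l-1}$ is order-isomorphic to $\tau$ (same relative order and same equalities among positions); "containing $\tau$ exactly $r$ times" means having exactly $r$ occurrences. Two patterns are in the same strong Wilf class if for all $k,n,r$ these counts coincide. -}

module Defs where

open import Data.Nat using (ℕ; zero; suc; _+_; _<ᵇ_; _≡ᵇ_)
open import Data.Bool using (Bool; true; false; _∧_; if_then_else_)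
open import Data.Fin using (Fin; toℕ)
open import Data.List using (List; []; _∷_; map; concatMap; length; drop; take; allFin; upTo)
open import Data.Vec using (Vec; toList)
import Data.Vec as Vec

-- Words in [k]^n: letters are Fin k (letter i stands for i+1).
-- allWords k n lists every element of [k]^n exactly once.
allWords : (k n : ℕ) → List (Vec (Fin k) n)
allWords k zero = Vec.[] ∷ []
allWords k (suc n) = concatMap (λ a → map (a Vec.∷_) (allWords k n)) (allFin k)

allᵇ : {A : Set} → (A → Bool) → List A → Bool
allᵇ p [] = true
allᵇ p (x ∷ xs) = p x ∧ allᵇ p xs

countᵇ : {A : Set} → (A → Bool) → List A → ℕ
countᵇ p [] = 0
countᵇ p (x ∷ xs) = (if p x then 1 else 0) + countᵇ p xs

data Ord3 : Set where lt eq gt : Ord3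

cmp : ℕ → ℕ → Ord3
cmp a b = if a <ᵇ b then lt else (if a ≡ᵇ b then eq else gt)

sameOrd : Ord3 → Ord3 → Bool
sameOrd lt lt = true
sameOrd eq eq = true
sameOrd gt gt = true
sameOrd _ _ = false

orderIso : List ℕ → List ℕ → Bool
orderIso xs ys =
  (length xs ≡ᵇ length ys) ∧
  allᵇ (λ p → allᵇ (λ q → sameOrd (cmp (nth xs p) (nth xs q)) (cmp (nth ys p) (nth ys q)))
                 (upTo (length xs)))
      (upTo (length xs))
  where
  nth : List ℕ → ℕ → ℕ
  nth [] _ = 0
  nth (x ∷ _) zero = x
  nth (_ ∷ xs) (suc i) = nth xs i

occurrences : List ℕ → List ℕ → ℕ
occurrences τ w = countᵇ (λ i → orderIso (take (length τ) (drop i w)) τ) (upTo (length w))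
-- Note: a factor starting too late is shorter than τ and is rejected by the length check.

wordToList : ∀ {k n} → Vec (Fin k) n → List ℕ
wordToList w = map (λ a → suc (toℕ a)) (toList w)

countExactly : List ℕ → (k n r : ℕ) → ℕ
countExactly τ k n r =
  countᵇ (λ w → occurrences τ (wordToList w) ≡ᵇ r) (allWords k n)

pat1121 : List ℕ
pat1121 = 1 ∷ 1 ∷ 2 ∷ 1 ∷ []

pat1221 : List ℕ
pat1221 = 1 ∷ 2 ∷ 2 ∷ 1 ∷ []

{-# OPTIONS --safe #-}
module Submission where

open import Defs
open import Level using (0ℓ)
open import Data.Bool using (Bool; true; false; if_then_else_)
open import Data.Empty using (⊥-elim)
open import Data.Fin using (Fin; toℕ)
open import Data.Fin.Properties using (toℕ-injective)
open import Data.List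
  using (List; []; _∷_; _++_; map; length; take; drop; concatMap; cartesianProductWith; allFin; upTo)
open import Data.List.Properties using (map-applyUpTo; map-∘; ∷-injectiveˡ; ∷-injectiveʳ)
open import Data.List.Membership.Propositional using (_∈_)
open import Data.List.Membership.Propositional.Properties using (∈-map⁺; ∈-allFin; ∈-cartesianProductWith⁺)
open import Data.List.Membership.Propositional.Properties.WithK using (unique∧set⇒bag)
open import Data.List.Relation.Binary.BagAndSetEquality using (∼bag⇒↭)
open import Data.List.Relation.Binary.Permutation.Propositional using (_↭_)
open import Data.List.Relation.Binary.Permutation.Propositional.Properties using (map⁺)
open import Data.List.Relation.Unary.Any using (here)
open import Data.List.Relation.Unary.All using ([])
open import Data.List.Relation.Unary.AllPairs using ([]; _∷_)
open import Data.List.Relation.Unary.Unique.Propositional using (Unique)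
import Data.List.Relation.Unary.Unique.Propositional.Properties as Unique
open import Data.Maybe.Properties using (just-injective)
open import Data.Nat using (ℕ; zero; suc; _+_; _<_; _≥_; _<ᵇ_; _≡ᵇ_)
open import Data.Nat.ListAction using (sum)
open import Data.Nat.ListAction.Properties using (sum-↭)
open import Data.Nat.Properties
  using (<-irrefl; <-asym; <ᵇ-reflects-<; ≡ᵇ⇒≡; ≡⇒≡ᵇ; ≤∧≢⇒<; ≮⇒≥; suc-injective; <-isStrictTotalOrder)
  renaming (_≟_ to _≟ℕ_; _<?_ to _<?ℕ_)
open import Data.Product using (_×_; _,_; proj₁; proj₂)
open import Data.Vec using (Vec; toList)
import Data.Vec as Vec
import Data.Vec.Properties as Vecₚ
open import Function using (_∘_)
open import Function.Bundles using (mk⇔)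
open import Relation.Binary.Core using (Rel)
open import Relation.Binary.Structures using (IsDecStrictPartialOrder; IsStrictTotalOrder)
open import Relation.Binary.Construct.Add.Supremum.Strict _<_
  using (_<⁺_; [_]; <⁺-isDecStrictPartialOrder-≡)
open import Relation.Nullary.Construct.Add.Supremum using (_⁺; ⊤⁺; [_])
open import Relation.Binary.PropositionalEquality
  using (_≡_; _≢_; refl; sym; trans; cong; cong₂; subst; module ≡-Reasoning)
open import Relation.Nullary using (¬_; Dec; yes; no; does)
open import Relation.Nullary.Decidable using (dec-true; dec-false)
open import Relation.Nullary.Reflects using (ofʸ; ofⁿ; fromEquivalence)

-- An occurrence  a a c a  of 1121 and an occurrence  a c c a  of 1221 (a < c) differ only in
-- their second letter.  The map ψ = toggleWord rewrites, simultaneously for every window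
-- u x y z  of a word, the letter x to y if the window is an occurrence of 1121, to u if it is an
-- occurrence of 1221, and keeps it otherwise.  A case analysis of the seven letters around a
-- window shows that ψ turns the occurrences of 1221 exactly into the occurrences of 1121 and
-- that ψ ∘ ψ = id, so ψ is a bijection of [k]ⁿ exchanging the two statistics.

private variable
  A A′ : Set

countWindows : (A → A → A → A → Bool) → List A → ℕ
countWindows P (a ∷ b ∷ c ∷ d ∷ l) = (if P a b c d then 1 else 0) + countWindows P (b ∷ c ∷ d ∷ l)
countWindows P _                   = 0

countWindows-map : (f : A → A′) (P : A → A → A → A → Bool) (Q : A′ → A′ → A′ → A′ → Bool) →
                   (∀ a b c d → P a b c d ≡ Q (f a) (f b) (f c) (f d)) →
                   ∀ l → countWindows P l ≡ countWindows Q (map f l)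
countWindows-map f P Q P≡Q []                = refl
countWindows-map f P Q P≡Q (_ ∷ [])          = refl
countWindows-map f P Q P≡Q (_ ∷ _ ∷ [])      = refl
countWindows-map f P Q P≡Q (_ ∷ _ ∷ _ ∷ [])  = refl
countWindows-map f P Q P≡Q (a ∷ b ∷ c ∷ d ∷ l) =
  cong₂ (λ β n → (if β then 1 else 0) + n) (P≡Q a b c d) (countWindows-map f P Q P≡Q (b ∷ c ∷ d ∷ l))

countᵇ-map : (p : A′ → Bool) (f : A → A′) (xs : List A) → countᵇ p (map f xs) ≡ countᵇ (p ∘ f) xs
countᵇ-map p f []       = refl
countᵇ-map p f (x ∷ xs) = cong (_ +_) (countᵇ-map p f xs)

countᵇ-cong : {p q : A → Bool} → (∀ x → p x ≡ q x) → (xs : List A) → countᵇ p xs ≡ countᵇ q xs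
countᵇ-cong p≡q []       = refl
countᵇ-cong p≡q (x ∷ xs) = cong₂ (λ β n → (if β then 1 else 0) + n) (p≡q x) (countᵇ-cong p≡q xs)

countᵇ-sum : (p : A → Bool) (xs : List A) → countᵇ p xs ≡ sum (map (λ x → if p x then 1 else 0) xs)
countᵇ-sum p []       = refl
countᵇ-sum p (x ∷ xs) = cong (_ +_) (countᵇ-sum p xs)

countᵇ-↭ : (p : A → Bool) {xs ys : List A} → xs ↭ ys → countᵇ p xs ≡ countᵇ p ys
countᵇ-↭ p {xs} {ys} xs↭ys =
  trans (countᵇ-sum p xs) (trans (sum-↭ (map⁺ _ xs↭ys)) (sym (countᵇ-sum p ys)))

concatMap-map≡cartesianProductWith : ∀ {C : Set} (f : A → A′ → C) xs ys →
                concatMap (λ x → map (f x) ys) xs ≡ cartesianProductWith f xs ys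
concatMap-map≡cartesianProductWith f []       ys = refl
concatMap-map≡cartesianProductWith f (x ∷ xs) ys =
  cong (map (f x) ys ++_) (concatMap-map≡cartesianProductWith f xs ys)

involution-↭ : {xs : List A} → Unique xs → (∀ x → x ∈ xs) →
               (f : A → A) → (∀ x → f (f x) ≡ x) → map f xs ↭ xs
involution-↭ {xs = xs} unique complete f f∘f≡id = ∼bag⇒↭ (unique∧set⇒bag
  (Unique.map⁺ f-injective unique) unique
  (λ {x} → mk⇔ (λ _ → complete x) (λ _ → subst (_∈ map f xs) (f∘f≡id x) (∈-map⁺ f (complete (f x))))))
  where
  f-injective : ∀ {x y} → f x ≡ f y → x ≡ y
  f-injective {x} {y} fx≡fy = trans (sym (f∘f≡id x)) (trans (cong f fx≡fy) (f∘f≡id y))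

module WindowToggle {B : Set} {_<_ : Rel B 0ℓ} (<-isDSPO : IsDecStrictPartialOrder _≡_ _<_) where

  open IsDecStrictPartialOrder <-isDSPO using (_≟_; _<?_; irrefl; asym)

  private variable
    u x y z p q : B

  data Occ1121 : B → B → B → B → Set where
    occ : p < q → Occ1121 p p q p

  data Occ1221 : B → B → B → B → Set where
    occ : p < q → Occ1221 p q q p

  occ1121? : ∀ u x y z → Dec (Occ1121 u x y z)
  occ1121? u x y z with x ≟ u | z ≟ u | u <? y
  ... | yes refl | yes refl | yes u<y = yes (occ u<y)
  ... | no x≢u   | _        | _       = no λ { (occ _) → x≢u refl }
  ... | _        | no z≢u   | _       = no λ { (occ _) → z≢u refl }
  ... | _        | _        | no u≮y  = no λ { (occ u<y) → u≮y u<y }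

  occ1221? : ∀ u x y z → Dec (Occ1221 u x y z)
  occ1221? u x y z with y ≟ x | z ≟ u | u <? x
  ... | yes refl | yes refl | yes u<x = yes (occ u<x)
  ... | no y≢x   | _        | _       = no λ { (occ _) → y≢x refl }
  ... | _        | no z≢u   | _       = no λ { (occ _) → z≢u refl }
  ... | _        | _        | no u≮x  = no λ { (occ u<x) → u≮x u<x }

  occ1121⇒¬occ1221 : Occ1121 u x y z → ¬ Occ1221 u x y z
  occ1121⇒¬occ1221 (occ _) (occ p<p) = irrefl refl p<p

  Plain : B → B → B → B → Set
  Plain u x y z = ¬ Occ1121 u x y z × ¬ Occ1221 u x y z

  plain-if-x<u : ∀ u x y z → x < u → Plain u x y z
  plain-if-x<u _ _ _ _ x<u = (λ { (occ _) → irrefl refl x<u }) , (λ { (occ u<x) → asym u<x x<u })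

  plain-if-x<z : ∀ u x y z → x < z → Plain u x y z
  plain-if-x<z _ _ _ _ x<z = (λ { (occ _) → irrefl refl x<z }) , (λ { (occ z<x) → asym z<x x<z })

  plain-if-y<x : ∀ u x y z → y < x → Plain u x y z
  plain-if-y<x _ _ _ _ y<x = (λ { (occ x<y) → asym x<y y<x }) , (λ { (occ _) → irrefl refl y<x })

  plain-unless-u<y : ∀ u x y z → ¬ u < y → Plain u x y z
  plain-unless-u<y _ _ _ _ u≮y = (λ { (occ u<y) → u≮y u<y }) , (λ { (occ u<y) → u≮y u<y })

  plain-unless-z<y : ∀ u x y z → ¬ z < y → Plain u x y z
  plain-unless-z<y _ _ _ _ z≮y = (λ { (occ z<y) → z≮y z<y }) , (λ { (occ z<y) → z≮y z<y })

  data Window (u x y z : B) : Set where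
    is1121 : Occ1121 u x y z → Window u x y z
    is1221 : Occ1221 u x y z → Window u x y z
    plain  : Plain u x y z → Window u x y z

  window : ∀ u x y z → Window u x y z
  window u x y z with occ1121? u x y z | occ1221? u x y z
  ... | yes o | _      = is1121 o
  ... | no ¬o | yes o′ = is1221 o′
  ... | no ¬o | no ¬o′ = plain (¬o , ¬o′)

  pick : {C : Set} → Window u x y z → C → C → C → C
  pick (is1121 _) _ _ c = c
  pick (is1221 _) a _ _ = a
  pick (plain _)  _ b _ = b

  pick-map : {C D : Set} (f : C → D) (w : Window u x y z) (a b c : C) →
             f (pick w a b c) ≡ pick w (f a) (f b) (f c)
  pick-map f (is1121 _) a b c = refl
  pick-map f (is1221 _) a b c = refl
  pick-map f (plain _)  a b c = refl

  toggle : B → B → B → B → B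
  toggle u x y z = pick (window u x y z) u x y

  toggle-1121 : Occ1121 u x y z → toggle u x y z ≡ y
  toggle-1121 {u} {x} {y} {z} o with window u x y z
  ... | is1121 _       = refl
  ... | is1221 o′      = ⊥-elim (occ1121⇒¬occ1221 o o′)
  ... | plain (¬o , _) = ⊥-elim (¬o o)

  toggle-1221 : Occ1221 u x y z → toggle u x y z ≡ u
  toggle-1221 {u} {x} {y} {z} o′ with window u x y z
  ... | is1121 o        = ⊥-elim (occ1121⇒¬occ1221 o o′)
  ... | is1221 _        = refl
  ... | plain (_ , ¬o′) = ⊥-elim (¬o′ o′)

  toggle-plain : Plain u x y z → toggle u x y z ≡ x
  toggle-plain {u} {x} {y} {z} (¬o , ¬o′) with window u x y z
  ... | is1121 o  = ⊥-elim (¬o o)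
  ... | is1221 o′ = ⊥-elim (¬o′ o′)
  ... | plain _   = refl

  plain-toggle₄ : ∀ {b c d e} f g → Plain b c d e → Plain b c d (toggle d e f g)
  plain-toggle₄ {b} {c} {d} {e} f g pl with window d e f g
  ... | is1121 (occ p<q) = plain-unless-z<y b c _ _ (asym p<q)
  ... | is1221 (occ p<q) = plain-unless-z<y b c _ _ (irrefl refl)
  ... | plain _          = pl

  plain-toggle₃₄ : ∀ {b c d e} f g → Plain b c d e → Plain b c (toggle c d e f) (toggle d e f g)
  plain-toggle₃₄ {b} {c} {d} {e} f g pl with window c d e f
  ... | is1121 (occ p<q) =
    subst (Plain b _ _) (sym (toggle-plain (plain-if-y<x _ _ _ g p<q)))
          (plain-if-x<z b _ _ _ p<q)
  ... | is1221 (occ p<q) =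
    subst (Plain b _ _) (sym (toggle-plain (plain-if-y<x _ _ _ g p<q)))
          (plain-if-x<z b _ _ _ p<q)
  ... | plain _          = plain-toggle₄ f g pl

  plain-toggle₁₃₄ : ∀ a {b c d e} f g → Plain b c d e →
                    Plain (toggle a b c d) c (toggle c d e f) (toggle d e f g)
  plain-toggle₁₃₄ a {b} {c} {d} {e} f g pl with window a b c d
  ... | is1121 (occ p<q) =
    subst (λ d′ → Plain _ _ d′ _) (sym (toggle-plain (plain-if-x<u _ _ e f p<q)))
          (plain-if-y<x _ _ _ _ p<q)
  ... | is1221 (occ p<q) =
    subst (λ d′ → Plain _ _ d′ _) (sym (toggle-plain (plain-if-x<u _ _ e f p<q)))
          (plain-if-y<x _ _ _ _ p<q)
  ... | plain _          = plain-toggle₃₄ f g pl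

  toggled-1121 : ∀ a f g → p < q →
    let b′ = toggle a p p q; d′ = toggle p q p f; e′ = toggle q p f g in
    does (occ1121? b′ q d′ e′) ≡ does (occ1221? p p q p) × toggle b′ q d′ e′ ≡ p
  toggled-1121 {p} {q} a f g p<q
    rewrite toggle-plain (plain-if-x<z a p p q p<q)
          | toggle-plain (plain-if-y<x p q p f p<q)
          | toggle-plain (plain-if-x<u q p f g p<q) =
    trans (dec-false (occ1121? p q q p) (λ o → occ1121⇒¬occ1221 o (occ p<q)))
          (sym (dec-false (occ1221? p p q p) (occ1121⇒¬occ1221 (occ p<q)))) ,
    toggle-1221 (occ p<q)

  toggled-1221 : ∀ a f g → p < q →
    let b′ = toggle a p q q; d′ = toggle q q p f; e′ = toggle q p f g in
    does (occ1121? b′ p d′ e′) ≡ does (occ1221? p q q p) × toggle b′ p d′ e′ ≡ q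
  toggled-1221 {p} {q} a f g p<q
    rewrite toggle-plain (plain-if-x<z a p q q p<q)
          | toggle-plain (plain-if-y<x q q p f p<q)
          | toggle-plain (plain-if-x<u q p f g p<q) =
    trans (dec-true (occ1121? p p q p) (occ p<q)) (sym (dec-true (occ1221? p q q p) (occ p<q))) ,
    toggle-1121 (occ p<q)

  toggled-window : ∀ a b c d e f g →
    let b′ = toggle a b c d; c′ = toggle b c d e; d′ = toggle c d e f; e′ = toggle d e f g in
    does (occ1121? b′ c′ d′ e′) ≡ does (occ1221? b c d e) × toggle b′ c′ d′ e′ ≡ c
  toggled-window a b c d e f g with window b c d e
  ... | is1121 (occ p<q)    = toggled-1121 a f g p<q
  ... | is1221 (occ p<q)    = toggled-1221 a f g p<q
  ... | plain pl@(_ , ¬o′) =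
    trans (dec-false (occ1121? _ c _ _) (proj₁ (plain-toggle₁₃₄ a f g pl)))
          (sym (dec-false (occ1221? b c d e) ¬o′)) ,
    toggle-plain (plain-toggle₁₃₄ a f g pl)

  count1121 count1221 : List B → ℕ
  count1121 = countWindows λ u x y z → does (occ1121? u x y z)
  count1221 = countWindows λ u x y z → does (occ1221? u x y z)

  -- A word is read with the maximal letter ⊤ before its first and after its last letter;
  -- ⊤ never takes part in an occurrence, so the windows meeting the boundary are plain.
  module Padded (⊤ : B) (⊤-maximal : ∀ y → ¬ ⊤ < y) where

    peek : List B → ℕ → B
    peek []      _       = ⊤
    peek (x ∷ _) zero    = x
    peek (_ ∷ l) (suc i) = peek l i

    toggleAfter : B → List B → List B
    toggleAfter u []      = []
    toggleAfter u (x ∷ l) = toggle u x (peek l 0) (peek l 1) ∷ toggleAfter x l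

    toggle-⊤ˡ : ∀ x y z → toggle ⊤ x y z ≡ x
    toggle-⊤ˡ x y z = toggle-plain (plain-unless-u<y ⊤ x y z (⊤-maximal y))

    toggle-⊤ʳ : ∀ u x y → toggle u x y ⊤ ≡ x
    toggle-⊤ʳ u x y = toggle-plain (plain-unless-z<y u x y ⊤ (⊤-maximal y))

    count-toggleAfter : ∀ u l → count1121 (toggleAfter u l) ≡ count1221 l
    count-toggleAfter u []               = refl
    count-toggleAfter u (_ ∷ [])         = refl
    count-toggleAfter u (_ ∷ _ ∷ [])     = refl
    count-toggleAfter u (_ ∷ _ ∷ _ ∷ []) = refl
    count-toggleAfter u (x ∷ y ∷ z ∷ w ∷ l) =
      cong₂ (λ β n → (if β then 1 else 0) + n)
            (proj₁ (toggled-window u x y z w (peek l 0) (peek l 1)))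
            (count-toggleAfter x (y ∷ z ∷ w ∷ l))

    peek-toggleAfter : ∀ u l i →
      peek (toggleAfter u l) i ≡ toggle (peek (u ∷ l) i) (peek l i) (peek l (1 + i)) (peek l (2 + i))
    peek-toggleAfter u []      i       = sym (toggle-⊤ʳ _ ⊤ ⊤)
    peek-toggleAfter u (x ∷ l) zero    = refl
    peek-toggleAfter u (x ∷ l) (suc i) = peek-toggleAfter x l i

    toggleAfter-twice : ∀ a u l → toggleAfter (toggle a u (peek l 0) (peek l 1)) (toggleAfter u l) ≡ l
    toggleAfter-twice a u []      = refl
    toggleAfter-twice a u (x ∷ l) = cong₂ _∷_ x-restored (toggleAfter-twice u x l)
      where
      open ≡-Reasoning
      x-restored : toggle (toggle a u x (peek l 0)) (toggle u x (peek l 0) (peek l 1))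
                          (peek (toggleAfter x l) 0) (peek (toggleAfter x l) 1) ≡ x
      x-restored = begin
        toggle (toggle a u x (peek l 0)) (toggle u x (peek l 0) (peek l 1))
               (peek (toggleAfter x l) 0) (peek (toggleAfter x l) 1)
          ≡⟨ cong₂ (toggle _ _) (peek-toggleAfter x l 0) (peek-toggleAfter x l 1) ⟩
        toggle (toggle a u x (peek l 0)) (toggle u x (peek l 0) (peek l 1))
               (toggle x (peek l 0) (peek l 1) (peek l 2))
               (toggle (peek l 0) (peek l 1) (peek l 2) (peek l 3))
          ≡⟨ proj₂ (toggled-window a u x (peek l 0) (peek l 1) (peek l 2) (peek l 3)) ⟩
        x ∎

    toggleAfter-⊤-involutive : ∀ l → toggleAfter ⊤ (toggleAfter ⊤ l) ≡ l
    toggleAfter-⊤-involutive l =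
      trans (cong (λ v → toggleAfter v (toggleAfter ⊤ l)) (sym (toggle-⊤ˡ ⊤ (peek l 0) (peek l 1))))
            (toggleAfter-twice ⊤ ⊤ l)

    module Words {C : Set} (embed : C → B) where

      private variable
        m n : ℕ

      ⌊_⌋ : Vec C n → List B
      ⌊ w ⌋ = map embed (toList w)

      ⌊⌋-injective : (∀ {a b} → embed a ≡ embed b → a ≡ b) → {v w : Vec C n} → ⌊ v ⌋ ≡ ⌊ w ⌋ → v ≡ w
      ⌊⌋-injective inj {v = Vec.[]}    {Vec.[]}    _ = refl
      ⌊⌋-injective inj {v = x Vec.∷ v} {y Vec.∷ w} h =
        cong₂ Vec._∷_ (inj (∷-injectiveˡ h)) (⌊⌋-injective inj (∷-injectiveʳ h))

      toggleAfterᵛ : C → Vec C m → Vec C m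
      toggleAfterᵛ u Vec.[]                    = Vec.[]
      toggleAfterᵛ u (x Vec.∷ Vec.[])          = x Vec.∷ Vec.[]
      toggleAfterᵛ u (x Vec.∷ y Vec.∷ Vec.[])  = x Vec.∷ y Vec.∷ Vec.[]
      toggleAfterᵛ u (x Vec.∷ y Vec.∷ z Vec.∷ w) =
        pick (window (embed u) (embed x) (embed y) (embed z)) u x y
          Vec.∷ toggleAfterᵛ x (y Vec.∷ z Vec.∷ w)

      toggleWord : Vec C n → Vec C n
      toggleWord Vec.[]      = Vec.[]
      toggleWord (x Vec.∷ w) = x Vec.∷ toggleAfterᵛ x w

      ⌊toggleAfterᵛ⌋ : ∀ u (w : Vec C m) → ⌊ toggleAfterᵛ u w ⌋ ≡ toggleAfter (embed u) ⌊ w ⌋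
      ⌊toggleAfterᵛ⌋ u Vec.[]                   = refl
      ⌊toggleAfterᵛ⌋ u (x Vec.∷ Vec.[])         = cong (_∷ []) (sym (toggle-⊤ʳ _ _ ⊤))
      ⌊toggleAfterᵛ⌋ u (x Vec.∷ y Vec.∷ Vec.[]) =
        cong₂ _∷_ (sym (toggle-⊤ʳ _ _ _)) (cong (_∷ []) (sym (toggle-⊤ʳ _ _ ⊤)))
      ⌊toggleAfterᵛ⌋ u (x Vec.∷ y Vec.∷ z Vec.∷ w) =
        cong₂ _∷_ (pick-map embed (window _ _ _ _) u x y) (⌊toggleAfterᵛ⌋ x (y Vec.∷ z Vec.∷ w))

      ⌊toggleWord⌋ : ∀ (w : Vec C n) → ⌊ toggleWord w ⌋ ≡ toggleAfter ⊤ ⌊ w ⌋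
      ⌊toggleWord⌋ Vec.[]      = refl
      ⌊toggleWord⌋ (x Vec.∷ w) = cong₂ _∷_ (sym (toggle-⊤ˡ _ _ _)) (⌊toggleAfterᵛ⌋ x w)

      toggleWord-involutive : (∀ {a b} → embed a ≡ embed b → a ≡ b) →
                              ∀ (w : Vec C n) → toggleWord (toggleWord w) ≡ w
      toggleWord-involutive inj w = ⌊⌋-injective inj (begin
        ⌊ toggleWord (toggleWord w) ⌋          ≡⟨ ⌊toggleWord⌋ (toggleWord w) ⟩
        toggleAfter ⊤ ⌊ toggleWord w ⌋         ≡⟨ cong (toggleAfter ⊤) (⌊toggleWord⌋ w) ⟩
        toggleAfter ⊤ (toggleAfter ⊤ ⌊ w ⌋)    ≡⟨ toggleAfter-⊤-involutive ⌊ w ⌋ ⟩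
        ⌊ w ⌋                                  ∎)
        where open ≡-Reasoning

      count-toggleWord : ∀ (w : Vec C n) → count1121 ⌊ toggleWord w ⌋ ≡ count1221 ⌊ w ⌋
      count-toggleWord w = trans (cong count1121 (⌊toggleWord⌋ w)) (count-toggleAfter ⊤ ⌊ w ⌋)

data Comparison (a b : ℕ) : Ord3 → Set where
  less    : a < b → Comparison a b lt
  equal   : a ≡ b → Comparison a b eq
  greater : b < a → Comparison a b gt

comparison : ∀ a b → Comparison a b (cmp a b)
comparison a b with a <ᵇ b | <ᵇ-reflects-< a b
... | true  | ofʸ a<b = less a<b
... | false | ofⁿ a≮b with a ≡ᵇ b | fromEquivalence {A = a ≡ b} (≡ᵇ⇒≡ a b) (≡⇒≡ᵇ a b)
...   | true  | ofʸ a≡b = equal a≡b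
...   | false | ofⁿ a≢b = greater (≤∧≢⇒< (≮⇒≥ a≮b) (a≢b ∘ sym))

Comparison⇒cmp≡ : ∀ {a b o} → Comparison a b o → cmp a b ≡ o
Comparison⇒cmp≡ {a} {b} c with cmp a b | comparison a b
Comparison⇒cmp≡ (less _)      | lt | _           = refl
Comparison⇒cmp≡ (equal _)     | eq | _           = refl
Comparison⇒cmp≡ (greater _)   | gt | _           = refl
Comparison⇒cmp≡ (less a<b)    | eq | equal refl  = ⊥-elim (<-irrefl refl a<b)
Comparison⇒cmp≡ (less a<b)    | gt | greater b<a = ⊥-elim (<-asym a<b b<a)
Comparison⇒cmp≡ (equal refl)  | lt | less a<a    = ⊥-elim (<-irrefl refl a<a)
Comparison⇒cmp≡ (equal refl)  | gt | greater a<a = ⊥-elim (<-irrefl refl a<a)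
Comparison⇒cmp≡ (greater b<a) | lt | less a<b    = ⊥-elim (<-asym a<b b<a)
Comparison⇒cmp≡ (greater b<a) | eq | equal refl  = ⊥-elim (<-irrefl refl b<a)

cmp-refl : ∀ a → cmp a a ≡ eq
cmp-refl a = Comparison⇒cmp≡ {a} {a} (equal refl)

cmp-< : ∀ {a b} → a < b → cmp a b ≡ lt
cmp-< = Comparison⇒cmp≡ ∘ less

cmp-> : ∀ {a b} → b < a → cmp a b ≡ gt
cmp-> = Comparison⇒cmp≡ ∘ greater

sameOrd-eq-false : ∀ {a b} → a ≢ b → sameOrd (cmp a b) eq ≡ false
sameOrd-eq-false {a} {b} a≢b with cmp a b | comparison a b
... | lt | _         = refl
... | eq | equal a≡b = ⊥-elim (a≢b a≡b)
... | gt | _         = refl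

sameOrd-lt-false : ∀ {a b} → ¬ a < b → sameOrd (cmp a b) lt ≡ false
sameOrd-lt-false {a} {b} a≮b with cmp a b | comparison a b
... | lt | less a<b = ⊥-elim (a≮b a<b)
... | eq | _        = refl
... | gt | _        = refl

ℕ⁺-isDecStrictPartialOrder : IsDecStrictPartialOrder _≡_ _<⁺_
ℕ⁺-isDecStrictPartialOrder =
  <⁺-isDecStrictPartialOrder-≡ (IsStrictTotalOrder.isDecStrictPartialOrder <-isStrictTotalOrder)

open WindowToggle ℕ⁺-isDecStrictPartialOrder
open Padded ⊤⁺ (λ _ ())

-- orderIso evaluates its comparisons row by row, from left to right; each case below fixes the
-- comparisons up to the first one that fails.
orderIso-1121 : ∀ a b c d →
                orderIso (a ∷ b ∷ c ∷ d ∷ []) pat1121 ≡ does (occ1121? [ a ] [ b ] [ c ] [ d ])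
orderIso-1121 a b c d with occ1121? [ a ] [ b ] [ c ] [ d ]
... | yes (occ [ a<c ]) rewrite cmp-refl a | cmp-< a<c | cmp-> a<c | cmp-refl c = refl
... | no ¬o = not-1121 ¬o
  where
  not-1121 : ¬ Occ1121 [ a ] [ b ] [ c ] [ d ] → orderIso (a ∷ b ∷ c ∷ d ∷ []) pat1121 ≡ false
  not-1121 ¬o with b ≟ℕ a | a <?ℕ c | d ≟ℕ a
  ... | no b≢a   | _       | _    rewrite cmp-refl a | sameOrd-eq-false (b≢a ∘ sym) = refl
  ... | yes refl | no a≮c  | _    rewrite cmp-refl a | sameOrd-lt-false a≮c = refl
  ... | yes refl | yes a<c | no d≢a
    rewrite cmp-refl a | cmp-< a<c | sameOrd-eq-false (d≢a ∘ sym) = refl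
  ... | yes refl | yes a<c | yes refl = ⊥-elim (¬o (occ [ a<c ]))

orderIso-1221 : ∀ a b c d →
                orderIso (a ∷ b ∷ c ∷ d ∷ []) pat1221 ≡ does (occ1221? [ a ] [ b ] [ c ] [ d ])
orderIso-1221 a b c d with occ1221? [ a ] [ b ] [ c ] [ d ]
... | yes (occ [ a<b ]) rewrite cmp-refl a | cmp-< a<b | cmp-> a<b | cmp-refl b = refl
... | no ¬o = not-1221 ¬o
  where
  not-1221 : ¬ Occ1221 [ a ] [ b ] [ c ] [ d ] → orderIso (a ∷ b ∷ c ∷ d ∷ []) pat1221 ≡ false
  not-1221 ¬o with a <?ℕ b | a <?ℕ c | d ≟ℕ a | c ≟ℕ b
  ... | no a≮b  | _       | _      | _ rewrite cmp-refl a | sameOrd-lt-false a≮b = refl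
  ... | yes a<b | no a≮c  | _      | _ rewrite cmp-refl a | cmp-< a<b | sameOrd-lt-false a≮c = refl
  ... | yes a<b | yes a<c | no d≢a | _
    rewrite cmp-refl a | cmp-< a<b | cmp-< a<c | sameOrd-eq-false (d≢a ∘ sym) = refl
  ... | yes a<b | yes a<c | yes refl | no c≢b
    rewrite cmp-refl a | cmp-< a<b | cmp-< a<c | cmp-> a<b | cmp-refl b | sameOrd-eq-false (c≢b ∘ sym)
    = refl
  ... | yes a<b | yes _   | yes refl | yes refl = ⊥-elim (¬o (occ [ a<b ]))

countᵇ-upTo-suc : (p : ℕ → Bool) (n : ℕ) →
                  countᵇ p (upTo (suc n)) ≡ (if p 0 then 1 else 0) + countᵇ (p ∘ suc) (upTo n)
countᵇ-upTo-suc p n =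
  cong (_ +_) (trans (cong (countᵇ p) (sym (map-applyUpTo (λ i → i) suc n))) (countᵇ-map p suc (upTo n)))

occurrences-∷ : ∀ τ x l →
  occurrences τ (x ∷ l) ≡ (if orderIso (take (length τ) (x ∷ l)) τ then 1 else 0) + occurrences τ l
occurrences-∷ τ x l = countᵇ-upTo-suc (λ i → orderIso (take (length τ) (drop i (x ∷ l))) τ) (length l)

occurrences-countWindows : ∀ t₁ t₂ t₃ t₄ l →
  occurrences (t₁ ∷ t₂ ∷ t₃ ∷ t₄ ∷ []) l ≡
  countWindows (λ a b c d → orderIso (a ∷ b ∷ c ∷ d ∷ []) (t₁ ∷ t₂ ∷ t₃ ∷ t₄ ∷ [])) l
occurrences-countWindows t₁ t₂ t₃ t₄ []               = refl
occurrences-countWindows t₁ t₂ t₃ t₄ (_ ∷ [])         = refl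
occurrences-countWindows t₁ t₂ t₃ t₄ (_ ∷ _ ∷ [])     = refl
occurrences-countWindows t₁ t₂ t₃ t₄ (_ ∷ _ ∷ _ ∷ []) = refl
occurrences-countWindows t₁ t₂ t₃ t₄ (a ∷ b ∷ c ∷ d ∷ l) =
  trans (occurrences-∷ (t₁ ∷ t₂ ∷ t₃ ∷ t₄ ∷ []) a (b ∷ c ∷ d ∷ l))
        (cong (_ +_) (occurrences-countWindows t₁ t₂ t₃ t₄ (b ∷ c ∷ d ∷ l)))

occurrences-1121 : ∀ l → occurrences pat1121 l ≡ count1121 (map [_] l)
occurrences-1121 l = trans (occurrences-countWindows 1 1 2 1 l) (countWindows-map [_] _ _ orderIso-1121 l)

occurrences-1221 : ∀ l → occurrences pat1221 l ≡ count1221 (map [_] l)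
occurrences-1221 l = trans (occurrences-countWindows 1 2 2 1 l) (countWindows-map [_] _ _ orderIso-1221 l)

allWords-unique : ∀ k n → Unique (allWords k n)
allWords-unique k zero    = [] ∷ []
allWords-unique k (suc n) =
  subst Unique (sym (concatMap-map≡cartesianProductWith Vec._∷_ (allFin k) (allWords k n)))
    (Unique.cartesianProductWith⁺ Vec._∷_ Vecₚ.∷-injective (Unique.allFin⁺ k) (allWords-unique k n))

allWords-complete : ∀ k n (w : Vec (Fin k) n) → w ∈ allWords k n
allWords-complete k zero    Vec.[]      = here refl
allWords-complete k (suc n) (x Vec.∷ w) =
  subst (_ ∈_) (sym (concatMap-map≡cartesianProductWith Vec._∷_ (allFin k) (allWords k n)))
    (∈-cartesianProductWith⁺ Vec._∷_ (∈-allFin x) (allWords-complete k n w))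

module _ {k : ℕ} where

  letter : Fin k → ℕ ⁺
  letter a = [ suc (toℕ a) ]

  letter-injective : ∀ {a b} → letter a ≡ letter b → a ≡ b
  letter-injective = toℕ-injective ∘ suc-injective ∘ just-injective

  open Words letter public

  map-[]-wordToList : ∀ {n} (w : Vec (Fin k) n) → map [_] (wordToList w) ≡ ⌊ w ⌋
  map-[]-wordToList w = sym (map-∘ (toList w))

  occurrences-toggleWord : ∀ {n} (w : Vec (Fin k) n) →
    occurrences pat1121 (wordToList (toggleWord w)) ≡ occurrences pat1221 (wordToList w)
  occurrences-toggleWord w = begin
    occurrences pat1121 (wordToList (toggleWord w)) ≡⟨ occurrences-1121 (wordToList (toggleWord w)) ⟩
    count1121 (map [_] (wordToList (toggleWord w))) ≡⟨ cong count1121 (map-[]-wordToList (toggleWord w)) ⟩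
    count1121 ⌊ toggleWord w ⌋                     ≡⟨ count-toggleWord w ⟩
    count1221 ⌊ w ⌋                                ≡⟨ cong count1221 (map-[]-wordToList w) ⟨
    count1221 (map [_] (wordToList w))             ≡⟨ occurrences-1221 (wordToList w) ⟨
    occurrences pat1221 (wordToList w)             ∎
    where open ≡-Reasoning

corollary2p10 : (k n r : ℕ) → k ≥ 1 → countExactly pat1121 k n r ≡ countExactly pat1221 k n r
corollary2p10 k n r _ = begin
  countᵇ has-r-1121 (allWords k n)                    ≡⟨ countᵇ-↭ has-r-1121 toggleWord-permutes ⟨
  countᵇ has-r-1121 (map toggleWord (allWords k n))   ≡⟨ countᵇ-map has-r-1121 toggleWord (allWords k n) ⟩
  countᵇ (has-r-1121 ∘ toggleWord) (allWords k n)     ≡⟨ countᵇ-cong same-count (allWords k n) ⟩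
  countExactly pat1221 k n r                          ∎
  where
  open ≡-Reasoning
  has-r-1121 : Vec (Fin k) n → Bool
  has-r-1121 w = occurrences pat1121 (wordToList w) ≡ᵇ r
  same-count : ∀ w → has-r-1121 (toggleWord w) ≡ (occurrences pat1221 (wordToList w) ≡ᵇ r)
  same-count w = cong (_≡ᵇ r) (occurrences-toggleWord w)
  toggleWord-permutes : map toggleWord (allWords k n) ↭ allWords k n
  toggleWord-permutes = involution-↭ (allWords-unique k n) (allWords-complete k n) toggleWord
                          (toggleWord-involutive letter-injective)
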